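{- Let $A$ be a non-empty, irreducible, mature string. Then there is $k\in\{0,1,2,3\}$ such that $A_k$ splits as $P_1.\cdots.P_r$ where each $P_i$ is either one of the 24 common particles or a string all of whose runs have length at most $3$.
   Context: All strings are finite sequences over $\{0,1,2\}$; a run is a maximal block of consecutive equal digits. The base-3 look-and-say operation sends a string $A$, written as its runs $r_1\cdots r_k$ with $r_i$ consisting of $n_i$ copies of the digit $d_i$, to the string $A_1$ obtained by replacing each $r_i$ by the base-3 representation of $n_i$ (no leading zeros) followed by $d_i$, and concatenating; $A_0=A$, $A_{n+1}=(A_n)_1$. A string $A$ splits as $P_1.\cdots.P_r$ if $A=P_1\cdots P_r$ and $A_n=(P_1)_n\cdots(P_r)_n$ for all $n\ge0$; $A$ is irreducible if it does not split as $P.Q$ with $P,Q$ non-empty. Say a string satisfies the run bounds if it has no two consecutive $0$'s, no four consecutive $2$'s and no five consecutive $1$'s. A string $A$ is mature if $A$ satisfies the run bounds and $A=B_1$ for a string $B$ (its parent) that also satisfies the run bounds. The 24 common particles are: $10, 1110, 110, 2110, 122110, 11222110, 22110, 222110, 211, 1221, 112211, 12221, 2, 12, 1112, 112, 2112, 122112, 11222112, 22112, 222112, 22, 11110, 11112$. -}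

module Defs where

open import Data.Bool using (Bool; true; false; if_then_else_)
open import Data.Nat using (ℕ; zero; suc; _≤_; _<_)
open import Data.List using (List; []; _∷_; _++_; concat; map; reverse)
open import Data.List.Relation.Unary.All using (All)
open import Data.List.Membership.Propositional using (_∈_)
open import Data.Product using (_×_; _,_; Σ; ∃; ∃-syntax; proj₁; proj₂)
open import Data.Nat.DivMod using (_/_; _%_)
open import Data.Sum using (_⊎_)
open import Relation.Binary.PropositionalEquality using (_≡_; _≢_)
open import Relation.Nullary using (¬_)

data Digit : Set where
  d0 d1 d2 : Digit

Str : Set
Str = List Digit

eqD : Digit → Digit → Bool
eqD d0 d0 = true
eqD d1 d1 = true
eqD d2 d2 = true
eqD _  _  = false

-- Run-length decomposition: list of (length, digit) of the maximal runs, in order.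
-- runsFrom d n xs : the current run is n+1 copies of d, followed by xs.
runsFrom : Digit → ℕ → Str → List (ℕ × Digit)
runsFrom d n []       = (suc n , d) ∷ []
runsFrom d n (x ∷ xs) =
  if eqD x d then runsFrom d (suc n) xs
  else (suc n , d) ∷ runsFrom x 0 xs

runs : Str → List (ℕ × Digit)
runs []       = []
runs (x ∷ xs) = runsFrom x 0 xs

-- Base-3 representation (no leading zeros, most significant digit first)
-- of a natural number; base3 0 = [] (never used: run lengths are positive).
natDigit : ℕ → Digit
natDigit zero             = d0
natDigit (suc zero)       = d1
natDigit (suc (suc _))    = d2

-- least significant digit first; fuel f ≥ n suffices
base3Rev : ℕ → ℕ → Str
base3Rev zero    _       = []
base3Rev (suc f) zero    = []
base3Rev (suc f) (suc n) = natDigit (suc n % 3) ∷ base3Rev f (suc n / 3)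

base3 : ℕ → Str
base3 n = reverse (base3Rev n n)

lookSay : Str → Str
lookSay A = concat (map (λ r → base3 (proj₁ r) ++ (proj₂ r ∷ [])) (runs A))

iter : ℕ → Str → Str
iter zero    A = A
iter (suc n) A = lookSay (iter n A)

Splits : Str → List Str → Set
Splits A Ps = (A ≡ concat Ps) × ((n : ℕ) → iter n A ≡ concat (map (iter n) Ps))

NonEmpty : Str → Set
NonEmpty A = A ≢ []

Irreducible : Str → Set
Irreducible A = ¬ (Σ Str λ P → Σ Str λ Q → NonEmpty P × NonEmpty Q × Splits A (P ∷ Q ∷ []))

runOK : ℕ × Digit → Set
runOK (n , d0) = n ≤ 1
runOK (n , d1) = n ≤ 4
runOK (n , d2) = n ≤ 3

RunBounds : Str → Set
RunBounds A = All runOK (runs A)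

Mature : Str → Set
Mature A = RunBounds A × (Σ Str λ B → RunBounds B × lookSay B ≡ A)

commonParticles : List Str
commonParticles =
    (d1 ∷ d0 ∷ [])
  ∷ (d1 ∷ d1 ∷ d1 ∷ d0 ∷ [])
  ∷ (d1 ∷ d1 ∷ d0 ∷ [])
  ∷ (d2 ∷ d1 ∷ d1 ∷ d0 ∷ [])
  ∷ (d1 ∷ d2 ∷ d2 ∷ d1 ∷ d1 ∷ d0 ∷ [])
  ∷ (d1 ∷ d1 ∷ d2 ∷ d2 ∷ d2 ∷ d1 ∷ d1 ∷ d0 ∷ [])
  ∷ (d2 ∷ d2 ∷ d1 ∷ d1 ∷ d0 ∷ [])
  ∷ (d2 ∷ d2 ∷ d2 ∷ d1 ∷ d1 ∷ d0 ∷ [])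
  ∷ (d2 ∷ d1 ∷ d1 ∷ [])
  ∷ (d1 ∷ d2 ∷ d2 ∷ d1 ∷ [])
  ∷ (d1 ∷ d1 ∷ d2 ∷ d2 ∷ d1 ∷ d1 ∷ [])
  ∷ (d1 ∷ d2 ∷ d2 ∷ d2 ∷ d1 ∷ [])
  ∷ (d2 ∷ [])
  ∷ (d1 ∷ d2 ∷ [])
  ∷ (d1 ∷ d1 ∷ d1 ∷ d2 ∷ [])
  ∷ (d1 ∷ d1 ∷ d2 ∷ [])
  ∷ (d2 ∷ d1 ∷ d1 ∷ d2 ∷ [])
  ∷ (d1 ∷ d2 ∷ d2 ∷ d1 ∷ d1 ∷ d2 ∷ [])
  ∷ (d1 ∷ d1 ∷ d2 ∷ d2 ∷ d2 ∷ d1 ∷ d1 ∷ d2 ∷ [])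
  ∷ (d2 ∷ d2 ∷ d1 ∷ d1 ∷ d2 ∷ [])
  ∷ (d2 ∷ d2 ∷ d2 ∷ d1 ∷ d1 ∷ d2 ∷ [])
  ∷ (d2 ∷ d2 ∷ [])
  ∷ (d1 ∷ d1 ∷ d1 ∷ d1 ∷ d0 ∷ [])
  ∷ (d1 ∷ d1 ∷ d1 ∷ d1 ∷ d2 ∷ [])
  ∷ []

ShortRuns : Str → Set
ShortRuns A = All (λ r → proj₁ r ≤ 3) (runs A)

GoodPiece : Str → Set
GoodPiece P = (P ∈ commonParticles) ⊎ ShortRuns P

-- Since consecutive runs have different digits, the runs of A₁
-- emitted while the description of a run of A is read depend only on that run and its predecessor, so a
-- finite check over pairs of runs shows that look-and-say preserves the run bounds, and also the stronger
-- bound "every run has length at most 3". Strings of the shapes 10…, 111… and 1111… (the shown run not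
-- continued) are mapped to such strings again, so they start with 1 forever; hence a run 1111 preceded
-- by another digit is a splitting point, and in an irreducible A only the first run can be 1111. If it is
-- not, all runs of A are short. If A = 1111W, following the next few runs of W either exhibits the
-- particle 11110 or 11112, gives a string with short runs after at most three steps, or again produces
-- a splitting point.
module Submission where

open import Defs
open import Data.Bool using (true; false; if_then_else_)
open import Data.Empty using (⊥; ⊥-elim)
open import Data.Unit using (⊤; tt)
open import Data.Maybe using (Maybe; nothing; just)
import Data.Maybe.Properties as Maybe
open import Data.Nat using (ℕ; zero; suc; _+_; _≤_; z≤n; s≤s)
import Data.Nat.Properties as ℕ
open import Data.List using (List; []; _∷_; _++_; _∷ʳ_; concat; map; replicate)
open import Data.List.Properties using (++-assoc; ++-identityʳ; map-++; concat-++)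
import Data.List.Properties as List
open import Data.List.Relation.Unary.All as All using (All; []; _∷_; all?)
open import Data.List.Relation.Unary.All.Properties using (++⁺)
open import Data.List.Relation.Unary.Any using (here; there; any?)
open import Data.List.Membership.Propositional using (_∈_)
open import Data.Product using (_×_; Σ; ∃; ∃₂; _,_; proj₁; proj₂; map₁)
import Data.Product.Properties as Product
open import Data.Sum using (inj₁; inj₂)
open import Function using (_∘_)
open import Relation.Binary.Definitions using (DecidableEquality)
open import Relation.Binary.PropositionalEquality
open import Relation.Nullary using (Dec; yes; no; contradiction)
open import Relation.Nullary.Decidable using (True; toWitness; from-yes; ¬?; _×-dec_; _→-dec_)
open import Relation.Unary using (Decidable)

eqD-refl : ∀ d → eqD d d ≡ true
eqD-refl d0 = refl
eqD-refl d1 = refl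
eqD-refl d2 = refl

eqD⇒≡ : ∀ x d → eqD x d ≡ true → x ≡ d
eqD⇒≡ d0 d0 _ = refl
eqD⇒≡ d1 d1 _ = refl
eqD⇒≡ d2 d2 _ = refl
eqD⇒≡ d0 d1 ()
eqD⇒≡ d0 d2 ()
eqD⇒≡ d1 d0 ()
eqD⇒≡ d1 d2 ()
eqD⇒≡ d2 d0 ()
eqD⇒≡ d2 d1 ()

eqD⇒≢ : ∀ x d → eqD x d ≡ false → x ≢ d
eqD⇒≢ x x eq refl with () ← trans (sym (eqD-refl x)) eq

≢⇒eqD : ∀ x d → x ≢ d → eqD x d ≡ false
≢⇒eqD x d x≢d with eqD x d in eq
... | true  = contradiction (eqD⇒≡ x d eq) x≢d
... | false = refl

_≟_ : DecidableEquality Digit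
x ≟ d with eqD x d in eq
... | true  = yes (eqD⇒≡ x d eq)
... | false = no (eqD⇒≢ x d eq)

HeadNot : Digit → Str → Set
HeadNot d []      = ⊤
HeadNot d (x ∷ _) = x ≢ d

replicate-∷ʳ : ∀ n (x : Digit) → replicate (suc n) x ≡ replicate n x ∷ʳ x
replicate-∷ʳ zero    x = refl
replicate-∷ʳ (suc n) x = cong (x ∷_) (replicate-∷ʳ n x)

runsFrom-replicate : ∀ d k n W → runsFrom d k (replicate n d ++ W) ≡ runsFrom d (n + k) W
runsFrom-replicate d k zero    W = refl
runsFrom-replicate d k (suc n) W rewrite eqD-refl d =
  trans (runsFrom-replicate d (suc k) n W) (cong (λ m → runsFrom d m W) (ℕ.+-suc n k))

runsFrom-fresh : ∀ {d k W} → HeadNot d W → runsFrom d k W ≡ (suc k , d) ∷ runs W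
runsFrom-fresh {W = []}        _   = refl
runsFrom-fresh {d} {W = x ∷ _} x≢d rewrite ≢⇒eqD x d x≢d = refl

runs-run : ∀ n {x W} → HeadNot x W → runs (replicate (suc n) x ++ W) ≡ (suc n , x) ∷ runs W
runs-run n {x} {W} h = begin
  runsFrom x 0 (replicate n x ++ W) ≡⟨ runsFrom-replicate x 0 n W ⟩
  runsFrom x (n + 0) W              ≡⟨ cong (λ m → runsFrom x m W) (ℕ.+-identityʳ n) ⟩
  runsFrom x n W                    ≡⟨ runsFrom-fresh h ⟩
  (suc n , x) ∷ runs W              ∎
  where open ≡-Reasoning

infixr 5 _∷⟨_⟩_

data RunsWith (P : ℕ × Digit → Set) : Str → Set where
  []     : RunsWith P []
  _∷⟨_⟩_ : ∀ {n x W} → P (suc n , x) → HeadNot x W → RunsWith P W →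
           RunsWith P (replicate (suc n) x ++ W)

runsWith : ∀ {P S} → All P (runs S) → RunsWith P S
runsWith {S = []}        _  = []
runsWith {P} {S = x ∷ S} ps = go x 0 S ps
  where
  go : ∀ x k S → All P (runsFrom x k S) → RunsWith P (replicate (suc k) x ++ S)
  go x k []      (p ∷ []) = p ∷⟨ tt ⟩ []
  go x k (y ∷ S) ps with eqD y x in eq
  ... | true with refl ← eqD⇒≡ y x eq =
    subst (RunsWith P) (trans (cong (_++ S) (replicate-∷ʳ (suc k) x)) (++-assoc (replicate (suc k) x) _ S))
      (go x (suc k) S ps)
  ... | false with p ∷ ps′ ← ps = p ∷⟨ eqD⇒≢ y x eq ⟩ go y 0 S ps′

allRuns : ∀ {P S} → RunsWith P S → All P (runs S)
allRuns []             = []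
allRuns (_∷⟨_⟩_ {n} p h V) = subst (All _) (sym (runs-run n h)) (p ∷ allRuns V)

RunsWith-map : ∀ {P Q S} → (∀ {n x} → P (suc n , x) → Q (suc n , x)) → RunsWith P S → RunsWith Q S
RunsWith-map f []             = []
RunsWith-map f (p ∷⟨ h ⟩ V) = f p ∷⟨ h ⟩ RunsWith-map f V

describe : ℕ × Digit → Str
describe r = base3 (proj₁ r) ++ proj₂ r ∷ []

concat-map-describe-++ : ∀ R R′ →
  concat (map describe (R ++ R′)) ≡ concat (map describe R) ++ concat (map describe R′)
concat-map-describe-++ R R′ =
  trans (cong concat (map-++ describe R R′)) (sym (concat-++ (map describe R) (map describe R′)))

lookSay-run : ∀ n {x W} → HeadNot x W →
  lookSay (replicate (suc n) x ++ W) ≡ describe (suc n , x) ++ lookSay W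
lookSay-run n h = cong (concat ∘ map describe) (runs-run n h)

-- nothing: no digit read yet; just (d , k): the current run consists of suc k copies of d.
State : Set
State = Maybe (Digit × ℕ)

resume : State → Str → List (ℕ × Digit)
resume nothing        = runs
resume (just (d , k)) = runsFrom d k

scan : State → Str → List (ℕ × Digit) × State
scan s              []       = [] , s
scan nothing        (x ∷ xs) = scan (just (x , 0)) xs
scan (just (d , k)) (x ∷ xs) =
  if eqD x d then scan (just (d , suc k)) xs else map₁ ((suc k , d) ∷_) (scan (just (x , 0)) xs)

completed : State → Str → List (ℕ × Digit)
completed s xs = proj₁ (scan s xs)

after : State → Str → State
after s xs = proj₂ (scan s xs)

resume-++ : ∀ s xs ys → resume s (xs ++ ys) ≡ completed s xs ++ resume (after s xs) ys
resume-++ s              []       ys = refl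
resume-++ nothing        (x ∷ xs) ys = resume-++ (just (x , 0)) xs ys
resume-++ (just (d , k)) (x ∷ xs) ys with eqD x d
... | true  = resume-++ (just (d , suc k)) xs ys
... | false = cong ((suc k , d) ∷_) (resume-++ (just (x , 0)) xs ys)

after-∷ʳ : ∀ s X e → ∃ λ k → after s (X ∷ʳ e) ≡ just (e , k)
after-∷ʳ nothing        []      e = 0 , refl
after-∷ʳ (just (d , k)) []      e with eqD e d in eq
... | true  = suc k , cong (λ x → just (x , suc k)) (sym (eqD⇒≡ e d eq))
... | false = 0 , refl
after-∷ʳ nothing        (x ∷ X) e = after-∷ʳ (just (x , 0)) X e
after-∷ʳ (just (d , k)) (x ∷ X) e with eqD x d
... | true  = after-∷ʳ (just (d , suc k)) X e
... | false = after-∷ʳ (just (x , 0)) X e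

-- Splitting at a run boundary

EndsIn : Digit → Str → Set
EndsIn e P = ∃ λ P′ → P ≡ P′ ∷ʳ e

endsIn-replicate : ∀ {n x} → EndsIn x (replicate (suc n) x)
endsIn-replicate {n} {x} = replicate n x , replicate-∷ʳ n x

endsIn-++-replicate : ∀ {n x} P → EndsIn x (P ++ replicate (suc n) x)
endsIn-++-replicate {n} {x} P =
  P ++ replicate n x , trans (cong (P ++_) (replicate-∷ʳ n x)) (sym (++-assoc P (replicate n x) _))

runs-endsIn : ∀ {e P} → EndsIn e P →
  ∃₂ λ C k → ∀ Q → HeadNot e Q → runs (P ++ Q) ≡ C ++ (suc k , e) ∷ runs Q
runs-endsIn {e} (P′ , refl) with after-∷ʳ nothing P′ e
... | k , after≡ = C , k , λ Q h → begin
  runs ((P′ ∷ʳ e) ++ Q)                            ≡⟨ resume-++ nothing (P′ ∷ʳ e) Q ⟩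
  C ++ resume (after nothing (P′ ∷ʳ e)) Q          ≡⟨ cong (λ s → C ++ resume s Q) after≡ ⟩
  C ++ runsFrom e k Q                              ≡⟨ cong (C ++_) (runsFrom-fresh h) ⟩
  C ++ (suc k , e) ∷ runs Q                        ∎
  where
  open ≡-Reasoning
  C = completed nothing (P′ ∷ʳ e)

runs-++ : ∀ {e P Q} → EndsIn e P → HeadNot e Q → runs (P ++ Q) ≡ runs P ++ runs Q
runs-++ {e} {P} {Q} end h with runs-endsIn end
... | C , k , split = begin
  runs (P ++ Q)                      ≡⟨ split Q h ⟩
  C ++ (suc k , e) ∷ runs Q          ≡⟨ sym (++-assoc C _ (runs Q)) ⟩
  (C ++ (suc k , e) ∷ []) ++ runs Q  ≡⟨ cong (_++ runs Q) (sym runs-P) ⟩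
  runs P ++ runs Q                   ∎
  where
  open ≡-Reasoning
  runs-P : runs P ≡ C ++ (suc k , e) ∷ []
  runs-P = trans (cong runs (sym (++-identityʳ P))) (split [] tt)

lookSay-++ : ∀ {e P Q} → EndsIn e P → HeadNot e Q → lookSay (P ++ Q) ≡ lookSay P ++ lookSay Q
lookSay-++ {P = P} {Q} end h =
  trans (cong (concat ∘ map describe) (runs-++ end h)) (concat-map-describe-++ (runs P) (runs Q))

lookSay-endsIn : ∀ {e P} → EndsIn e P → EndsIn e (lookSay P)
lookSay-endsIn {e} {P} end with runs-endsIn end
... | C , k , split = X ++ base3 (suc k) , (begin
  concat (map describe (runs P))                 ≡⟨ cong (concat ∘ map describe) runs-P ⟩
  concat (map describe (C ++ (suc k , e) ∷ []))  ≡⟨ concat-map-describe-++ C _ ⟩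
  X ++ describe (suc k , e) ++ []                ≡⟨ cong (X ++_) (++-identityʳ _) ⟩
  X ++ base3 (suc k) ++ e ∷ []                   ≡⟨ sym (++-assoc X _ _) ⟩
  (X ++ base3 (suc k)) ∷ʳ e                      ∎)
  where
  open ≡-Reasoning
  X = concat (map describe C)
  runs-P : runs P ≡ C ++ (suc k , e) ∷ []
  runs-P = trans (cong runs (sym (++-identityʳ P))) (split [] tt)

iter-lookSay : ∀ n S → iter n (lookSay S) ≡ iter (suc n) S
iter-lookSay zero    S = refl
iter-lookSay (suc n) S = cong lookSay (iter-lookSay n S)

iter-endsIn : ∀ {e P} → EndsIn e P → ∀ n → EndsIn e (iter n P)
iter-endsIn end zero    = end
iter-endsIn end (suc n) = lookSay-endsIn (iter-endsIn end n)

iter-++ : ∀ {e P Q} → EndsIn e P → (∀ n → HeadNot e (iter n Q)) →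
  ∀ n → iter n (P ++ Q) ≡ iter n P ++ iter n Q
iter-++         end h zero    = refl
iter-++ {P = P} {Q} end h (suc n) = begin
  lookSay (iter n (P ++ Q))          ≡⟨ cong lookSay (iter-++ end h n) ⟩
  lookSay (iter n P ++ iter n Q)     ≡⟨ lookSay-++ (iter-endsIn end n) (h n) ⟩
  iter (suc n) P ++ iter (suc n) Q   ∎
  where open ≡-Reasoning

splits-at : ∀ {e P Q} → EndsIn e P → (∀ n → HeadNot e (iter n Q)) → Splits (P ++ Q) (P ∷ Q ∷ [])
splits-at {P = P} {Q} end h =
  cong (P ++_) (sym (++-identityʳ Q)) ,
  λ n → trans (iter-++ end h n) (cong (iter n P ++_) (sym (++-identityʳ (iter n Q))))

splits-trivially : ∀ X → Splits X (X ∷ [])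
splits-trivially X = sym (++-identityʳ X) , λ n → sym (++-identityʳ (iter n X))

irreducible-cannot-split : ∀ {e P Q} → Irreducible (P ++ Q) → EndsIn e P → NonEmpty Q →
  (∀ n → HeadNot e (iter n Q)) → ⊥
irreducible-cannot-split irr end@(P′ , refl) Q≢[] h = irr (_ , _ , ∷ʳ≢[] P′ , Q≢[] , splits-at end h)
  where
  ∷ʳ≢[] : ∀ P′ {e} → NonEmpty (P′ ∷ʳ e)
  ∷ʳ≢[] []      ()
  ∷ʳ≢[] (_ ∷ _) ()

-- Preservation of run bounds

exit : ℕ × Digit → State
exit p = after nothing (describe p)

module _ {P : ℕ × Digit → Set} (P? : Decidable P) (L : List (ℕ × Digit)) where

  Transition : ℕ × Digit → ℕ × Digit → Set
  Transition p q = All P (completed (exit p) (describe q)) × after (exit p) (describe q) ≡ exit q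

  -- While lookSay S is read, the description of a run q of S is entered in the state exit p, p the run
  -- before q, because the digits of p and q differ. So every run of lookSay S is one listed in Closed L.
  Closed : Set
  Closed = All (λ p → All P (completed nothing (describe p)) × All P (resume (exit p) []) ×
                      All (λ q → proj₂ q ≢ proj₂ p → Transition p q) L) L

  closed? : Dec Closed
  closed? = all? (λ p → all? P? (completed nothing (describe p)) ×-dec all? P? (resume (exit p) []) ×-dec
                        all? (λ q → ¬? (proj₂ q ≟ proj₂ p) →-dec transition? p q) L) L
    where
    transition? : ∀ p q → Dec (Transition p q)
    transition? p q = all? P? (completed (exit p) (describe q)) ×-dec
                      Maybe.≡-dec (Product.≡-dec _≟_ ℕ._≟_) (after (exit p) (describe q)) (exit q)

  module _ (complete : ∀ {r} → P r → r ∈ L) (closed : Closed) where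

    private
      entry : ∀ {p} → P p → All P (completed nothing (describe p))
      entry = proj₁ ∘ All.lookup closed ∘ complete

      final : ∀ {p} → P p → All P (resume (exit p) [])
      final = proj₁ ∘ proj₂ ∘ All.lookup closed ∘ complete

      transition : ∀ {p q} → P p → P q → proj₂ q ≢ proj₂ p → Transition p q
      transition Pp Pq = All.lookup (proj₂ (proj₂ (All.lookup closed (complete Pp)))) (complete Pq)

      resume-exit : ∀ {p W} → P p → HeadNot (proj₂ p) W → RunsWith P W →
                    All P (resume (exit p) (lookSay W))
      resume-exit Pp _ [] = final Pp
      resume-exit {p} Pp q≢p (_∷⟨_⟩_ {n} {x} {W} Pq h V) with transition Pp Pq q≢p
      ... | emitted , after≡ = subst (All P) (sym resume≡)
            (++⁺ emitted (subst (λ s → All P (resume s (lookSay W))) (sym after≡) (resume-exit Pq h V)))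
        where
        q = (suc n , x)
        resume≡ : resume (exit p) (lookSay (replicate (suc n) x ++ W)) ≡
                  completed (exit p) (describe q) ++ resume (after (exit p) (describe q)) (lookSay W)
        resume≡ = trans (cong (resume (exit p)) (lookSay-run n h)) (resume-++ (exit p) (describe q) (lookSay W))

    lookSay-closed : ∀ {S} → RunsWith P S → All P (runs (lookSay S))
    lookSay-closed [] = []
    lookSay-closed (_∷⟨_⟩_ {n} {x} {W} Pp h V) = subst (All P) (sym runs≡) (++⁺ (entry Pp) (resume-exit Pp h V))
      where
      runs≡ : runs (lookSay (replicate (suc n) x ++ W)) ≡
              completed nothing (describe (suc n , x)) ++ resume (exit (suc n , x)) (lookSay W)
      runs≡ = trans (cong runs (lookSay-run n h)) (resume-++ nothing (describe (suc n , x)) (lookSay W))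

data ShortRun : ℕ × Digit → Set where
  0¹ : ShortRun (1 , d0)
  1¹ : ShortRun (1 , d1)
  1² : ShortRun (2 , d1)
  1³ : ShortRun (3 , d1)
  2¹ : ShortRun (1 , d2)
  2² : ShortRun (2 , d2)
  2³ : ShortRun (3 , d2)

data BoundedRun : ℕ × Digit → Set where
  short : ∀ {r} → ShortRun r → BoundedRun r
  1⁴    : BoundedRun (4 , d1)

shortRun? : Decidable ShortRun
shortRun? (1 , d0) = yes 0¹
shortRun? (1 , d1) = yes 1¹
shortRun? (2 , d1) = yes 1²
shortRun? (3 , d1) = yes 1³
shortRun? (1 , d2) = yes 2¹
shortRun? (2 , d2) = yes 2²
shortRun? (3 , d2) = yes 2³
shortRun? (0 , _)                            = no λ ()
shortRun? (suc (suc _) , d0)                 = no λ ()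
shortRun? (suc (suc (suc (suc _))) , d1)     = no λ ()
shortRun? (suc (suc (suc (suc _))) , d2)     = no λ ()

boundedRun? : Decidable BoundedRun
boundedRun? r with shortRun? r | Product.≡-dec ℕ._≟_ _≟_ r (4 , d1)
... | yes s  | _        = yes (short s)
... | no _   | yes refl = yes 1⁴
... | no ¬s  | no r≢    = no λ { (short s) → ¬s s ; 1⁴ → r≢ refl }

shortRuns : List (ℕ × Digit)
shortRuns = (1 , d0) ∷ (1 , d1) ∷ (2 , d1) ∷ (3 , d1) ∷ (1 , d2) ∷ (2 , d2) ∷ (3 , d2) ∷ []

∈-shortRuns : ∀ {r} → ShortRun r → r ∈ shortRuns
∈-shortRuns 0¹ = here refl
∈-shortRuns 1¹ = there (here refl)
∈-shortRuns 1² = there (there (here refl))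
∈-shortRuns 1³ = there (there (there (here refl)))
∈-shortRuns 2¹ = there (there (there (there (here refl))))
∈-shortRuns 2² = there (there (there (there (there (here refl)))))
∈-shortRuns 2³ = there (there (there (there (there (there (here refl))))))

∈-boundedRuns : ∀ {r} → BoundedRun r → r ∈ (4 , d1) ∷ shortRuns
∈-boundedRuns (short s) = there (∈-shortRuns s)
∈-boundedRuns 1⁴        = here refl

Short Bounded : Str → Set
Short   = RunsWith ShortRun
Bounded = RunsWith BoundedRun

short-lookSay : ∀ {S} → Short S → Short (lookSay S)
short-lookSay =
  runsWith ∘ lookSay-closed shortRun? shortRuns ∈-shortRuns (from-yes (closed? shortRun? shortRuns))

bounded-lookSay : ∀ {S} → Bounded S → Bounded (lookSay S)
bounded-lookSay = runsWith ∘ lookSay-closed boundedRun? ((4 , d1) ∷ shortRuns) ∈-boundedRuns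
                               (from-yes (closed? boundedRun? ((4 , d1) ∷ shortRuns)))

bounded-run : ∀ {n x} → runOK (suc n , x) → BoundedRun (suc n , x)
bounded-run {0} {d0} _ = short 0¹
bounded-run {0} {d1} _ = short 1¹
bounded-run {1} {d1} _ = short 1²
bounded-run {2} {d1} _ = short 1³
bounded-run {3} {d1} _ = 1⁴
bounded-run {0} {d2} _ = short 2¹
bounded-run {1} {d2} _ = short 2²
bounded-run {2} {d2} _ = short 2³
bounded-run {suc _}                   {d0} (s≤s ())
bounded-run {suc (suc (suc (suc _)))} {d1} (s≤s (s≤s (s≤s (s≤s ()))))
bounded-run {suc (suc (suc _))}       {d2} (s≤s (s≤s (s≤s ())))

runBounds⇒bounded : ∀ {S} → RunBounds S → Bounded S
runBounds⇒bounded = RunsWith-map bounded-run ∘ runsWith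

shortRun-length : ∀ {r} → ShortRun r → proj₁ r ≤ 3
shortRun-length 0¹ = s≤s z≤n
shortRun-length 1¹ = s≤s z≤n
shortRun-length 1² = s≤s (s≤s z≤n)
shortRun-length 1³ = ℕ.≤-refl
shortRun-length 2¹ = s≤s z≤n
shortRun-length 2² = s≤s (s≤s z≤n)
shortRun-length 2³ = ℕ.≤-refl

short⇒bounded : ∀ {S} → Short S → Bounded S
short⇒bounded = RunsWith-map short

runsWith-tail : ∀ {P} n {x W} → HeadNot x W → RunsWith P (replicate (suc n) x ++ W) → RunsWith P W
runsWith-tail {P} n h = runsWith ∘ All.tail ∘ subst (All P) (runs-run n h) ∘ allRuns

bounded-iter : ∀ {S} → Bounded S → ∀ n → Bounded (iter n S)
bounded-iter b zero    = b
bounded-iter b (suc n) = bounded-lookSay (bounded-iter b n)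

describe-head≢0 : ∀ {r X} → BoundedRun r → HeadNot d0 (describe r ++ X)
describe-head≢0 (short 0¹) ()
describe-head≢0 (short 1¹) ()
describe-head≢0 (short 1²) ()
describe-head≢0 (short 1³) ()
describe-head≢0 (short 2¹) ()
describe-head≢0 (short 2²) ()
describe-head≢0 (short 2³) ()
describe-head≢0 1⁴         ()

lookSay-head≢0 : ∀ {S} → RunsWith BoundedRun S → HeadNot d0 (lookSay S)
lookSay-head≢0 []                       = tt
lookSay-head≢0 (_∷⟨_⟩_ {n} b h _) = subst (HeadNot d0) (sym (lookSay-run n h)) (describe-head≢0 b)

iter-head≢0 : ∀ {Q} → Bounded Q → HeadNot d0 Q → ∀ n → HeadNot d0 (iter n Q)
iter-head≢0 _ h zero    = h
iter-head≢0 b _ (suc n) = lookSay-head≢0 (bounded-iter b n)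

-- Strings that start with 1 forever

data OneCycle : Str → Set where
  10…   : ∀ {W} → HeadNot d0 W → OneCycle (d1 ∷ d0 ∷ W)
  111…  : ∀ {W} → HeadNot d1 W → OneCycle (d1 ∷ d1 ∷ d1 ∷ W)
  1111… : ∀ {W} → HeadNot d1 W → OneCycle (d1 ∷ d1 ∷ d1 ∷ d1 ∷ W)

cycle-111-describe : ∀ {n y W} → BoundedRun (suc n , y) → HeadNot d1 (replicate (suc n) y ++ W) →
  OneCycle (d1 ∷ d1 ∷ d1 ∷ describe (suc n , y) ++ W)
cycle-111-describe (short 0¹) _ = 1111… (λ ())
cycle-111-describe (short 2¹) _ = 1111… (λ ())
cycle-111-describe (short 2²) _ = 111… (λ ())
cycle-111-describe (short 2³) _ = 1111… (λ ())
cycle-111-describe (short 1¹) h = contradiction refl h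
cycle-111-describe (short 1²) h = contradiction refl h
cycle-111-describe (short 1³) h = contradiction refl h
cycle-111-describe 1⁴         h = contradiction refl h

cycle-lookSay : ∀ {V} → OneCycle V → Bounded V → OneCycle (lookSay V)
cycle-lookSay (10… h)  _ = subst OneCycle (sym (lookSay-++ (d1 ∷ [] , refl) h)) (111… (λ ()))
cycle-lookSay (111… h) _ = subst OneCycle (sym (lookSay-run 2 h)) (10… (λ ()))
cycle-lookSay (1111… h) b = after-1111 h (runsWith-tail 3 h b)
  where
  after-1111 : ∀ {W} → HeadNot d1 W → Bounded W → OneCycle (lookSay (d1 ∷ d1 ∷ d1 ∷ d1 ∷ W))
  after-1111 _ []                             = 111… tt
  after-1111 h (_∷⟨_⟩_ {n} {y} {W′} b′ h′ _) = subst OneCycle (sym lookSay≡) (cycle-111-describe b′ h)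
    where
    lookSay≡ : lookSay (d1 ∷ d1 ∷ d1 ∷ d1 ∷ replicate (suc n) y ++ W′) ≡
               d1 ∷ d1 ∷ d1 ∷ describe (suc n , y) ++ lookSay W′
    lookSay≡ = trans (lookSay-run 3 {W = replicate (suc n) y ++ W′} h)
                     (cong (λ X → d1 ∷ d1 ∷ d1 ∷ X) (lookSay-run n h′))

cycle-head : ∀ {e V} → e ≢ d1 → OneCycle V → HeadNot e V
cycle-head e≢1 (10… _)   = e≢1 ∘ sym
cycle-head e≢1 (111… _)  = e≢1 ∘ sym
cycle-head e≢1 (1111… _) = e≢1 ∘ sym

cycle-iter-head : ∀ {e V} → e ≢ d1 → OneCycle V → Bounded V → ∀ n → HeadNot e (iter n V)
cycle-iter-head {V = V} e≢1 c b n = cycle-head e≢1 (cycle-iter n)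
  where
  cycle-iter : ∀ n → OneCycle (iter n V)
  cycle-iter zero    = c
  cycle-iter (suc n) = cycle-lookSay (cycle-iter n) (bounded-iter b n)

lookSay-cycle-iter-head : ∀ {e Q} → e ≢ d1 → HeadNot e Q → Bounded Q → OneCycle (lookSay Q) →
  ∀ n → HeadNot e (iter n Q)
lookSay-cycle-iter-head         _   h _ _ zero    = h
lookSay-cycle-iter-head {e} {Q} e≢1 _ b c (suc n) =
  subst (HeadNot e) (iter-lookSay n Q) (cycle-iter-head e≢1 c (bounded-lookSay b) n)

-- Irreducible strings

later-runs-short : ∀ {e P W} → Irreducible (P ++ W) → EndsIn e P → HeadNot e W → Bounded W → Short W
later-runs-short _ _ _ [] = []
later-runs-short {P = P} irr _ _ (_∷⟨_⟩_ {n} {x} {W} (short s) h V) =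
  s ∷⟨ h ⟩ later-runs-short (subst Irreducible (sym (++-assoc P (replicate (suc n) x) W)) irr)
                            (endsIn-++-replicate P) h V
later-runs-short irr end 1≢e (1⁴ ∷⟨ h ⟩ V) =
  ⊥-elim (irreducible-cannot-split irr end (λ ()) (cycle-iter-head (1≢e ∘ sym) (1111… h) (1⁴ ∷⟨ h ⟩ V)))

GoodSplitting : Str → Set
GoodSplitting A = Σ ℕ λ k → k ≤ 3 × Σ (List Str) λ Ps → Splits (iter k A) Ps × All GoodPiece Ps

IsCommon : Str → Set
IsCommon X = True (any? (List.≡-dec _≟_ X) commonParticles)

short-piece : ∀ {X} → Short X → GoodPiece X
short-piece = inj₂ ∘ All.map shortRun-length ∘ allRuns

common-piece : ∀ {X} {isCommon : IsCommon X} → GoodPiece X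
common-piece {isCommon = isCommon} = inj₁ (toWitness isCommon)

short-goodSplitting : ∀ {A} k → k ≤ 3 → Short (iter k A) → GoodSplitting A
short-goodSplitting k k≤3 s = k , k≤3 , _ ∷ [] , splits-trivially _ , short-piece s ∷ []

common-goodSplitting : ∀ {A} {isCommon : IsCommon A} → GoodSplitting A
common-goodSplitting {isCommon = isCommon} =
  0 , z≤n , _ ∷ [] , splits-trivially _ , common-piece {isCommon = isCommon} ∷ []

short-1∷lookSay : ∀ {Y} → HeadNot d1 Y → Short Y → Short (d1 ∷ lookSay Y)
short-1∷lookSay h sY =
  runsWith-tail 0 (λ ()) (subst Short (lookSay-run 1 h) (short-lookSay (1² ∷⟨ h ⟩ sY)))

short-after-111122 : ∀ {Y} → HeadNot d2 Y → Short Y →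
  Short (lookSay (d1 ∷ d1 ∷ d1 ∷ d1 ∷ d2 ∷ d2 ∷ Y))
short-after-111122 {Y} h sY =
  subst Short (sym lookSay≡)
    (1³ ∷⟨ (λ ()) ⟩ subst Short (lookSay-run 1 h) (short-lookSay (2² ∷⟨ h ⟩ sY)))
  where
  lookSay≡ : lookSay (d1 ∷ d1 ∷ d1 ∷ d1 ∷ d2 ∷ d2 ∷ Y) ≡ d1 ∷ d1 ∷ d1 ∷ d2 ∷ d2 ∷ lookSay Y
  lookSay≡ = trans (lookSay-run 3 {W = d2 ∷ d2 ∷ Y} (λ ()))
                   (cong (λ X → d1 ∷ d1 ∷ d1 ∷ X) (lookSay-run 1 h))

irreducible-cannot-split-11112 : ∀ {Q} → Irreducible (d1 ∷ d1 ∷ d1 ∷ d1 ∷ d2 ∷ Q) → NonEmpty Q →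
  HeadNot d2 Q → Bounded Q → OneCycle (lookSay Q) → ⊥
irreducible-cannot-split-11112 irr Q≢[] h b c =
  irreducible-cannot-split irr (d1 ∷ d1 ∷ d1 ∷ d1 ∷ [] , refl) Q≢[] (lookSay-cycle-iter-head (λ ()) h b c)

lookSay-1∷ : ∀ n {x W} → x ≢ d1 → HeadNot x W →
  lookSay (d1 ∷ replicate (suc n) x ++ W) ≡ d1 ∷ d1 ∷ describe (suc n , x) ++ lookSay W
lookSay-1∷ n {x} {W} x≢1 h =
  trans (lookSay-run 0 {W = replicate (suc n) x ++ W} x≢1) (cong (λ X → d1 ∷ d1 ∷ X) (lookSay-run n h))

leading-111121 : ∀ {W} → HeadNot d1 W → Short W → Irreducible (d1 ∷ d1 ∷ d1 ∷ d1 ∷ d2 ∷ d1 ∷ W) →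
  GoodSplitting (d1 ∷ d1 ∷ d1 ∷ d1 ∷ d2 ∷ d1 ∷ W)
leading-111121 _ [] _ = short-goodSplitting 3 ℕ.≤-refl (1³ ∷⟨ (λ ()) ⟩ 2² ∷⟨ (λ ()) ⟩ 1² ∷⟨ tt ⟩ [])
leading-111121 h (0¹ ∷⟨ h′ ⟩ V) irr =
  ⊥-elim (irreducible-cannot-split-11112 irr (λ ()) (λ ()) b (cycle-lookSay (10… h′) b))
  where b = short⇒bounded (1¹ ∷⟨ h ⟩ 0¹ ∷⟨ h′ ⟩ V)
leading-111121 h (2¹ ∷⟨ h′ ⟩ V) irr =
  ⊥-elim (irreducible-cannot-split-11112 irr (λ ()) (λ ()) (short⇒bounded (1¹ ∷⟨ h ⟩ 2¹ ∷⟨ h′ ⟩ V))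
            (subst OneCycle (sym (lookSay-1∷ 0 (λ ()) h′)) (111… (λ ()))))
leading-111121 h (2³ ∷⟨ h′ ⟩ V) irr =
  ⊥-elim (irreducible-cannot-split-11112 irr (λ ()) (λ ()) (short⇒bounded (1¹ ∷⟨ h ⟩ 2³ ∷⟨ h′ ⟩ V))
            (subst OneCycle (sym (lookSay-1∷ 2 (λ ()) h′)) (111… (λ ()))))
leading-111121 _ (_∷⟨_⟩_ {W = W} 2² h V) _ =
  short-goodSplitting 3 ℕ.≤-refl
    (subst (Short ∘ lookSay) (sym iter²≡) (short-after-111122 (λ ()) (short-1∷lookSay (λ ()) short-22L)))
  where
  L = lookSay W
  iter²≡ : lookSay (lookSay (d1 ∷ d1 ∷ d1 ∷ d1 ∷ d2 ∷ d1 ∷ d2 ∷ d2 ∷ W)) ≡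
           d1 ∷ d1 ∷ d1 ∷ d1 ∷ d2 ∷ d2 ∷ d1 ∷ lookSay (d2 ∷ d2 ∷ L)
  iter²≡ = begin
    lookSay (lookSay ((d1 ∷ d1 ∷ d1 ∷ d1 ∷ d2 ∷ d1 ∷ []) ++ d2 ∷ d2 ∷ W))
      ≡⟨ cong lookSay (lookSay-++ {d1} {Q = d2 ∷ d2 ∷ W} (d1 ∷ d1 ∷ d1 ∷ d1 ∷ d2 ∷ [] , refl) (λ ())) ⟩
    lookSay ((d1 ∷ d1 ∷ d1 ∷ d1 ∷ d2 ∷ d1 ∷ d1 ∷ []) ++ lookSay (d2 ∷ d2 ∷ W))
      ≡⟨ cong (λ X → lookSay ((d1 ∷ d1 ∷ d1 ∷ d1 ∷ d2 ∷ d1 ∷ d1 ∷ []) ++ X)) (lookSay-run 1 h) ⟩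
    lookSay ((d1 ∷ d1 ∷ d1 ∷ d1 ∷ d2 ∷ d1 ∷ d1 ∷ []) ++ d2 ∷ d2 ∷ L)
      ≡⟨ lookSay-++ {d1} {Q = d2 ∷ d2 ∷ L} (d1 ∷ d1 ∷ d1 ∷ d1 ∷ d2 ∷ d1 ∷ [] , refl) (λ ()) ⟩
    d1 ∷ d1 ∷ d1 ∷ d1 ∷ d2 ∷ d2 ∷ d1 ∷ lookSay (d2 ∷ d2 ∷ L)
      ∎
    where open ≡-Reasoning
  short-22L : Short (d2 ∷ d2 ∷ L)
  short-22L = subst Short (lookSay-run 1 h) (short-lookSay (2² ∷⟨ h ⟩ V))
leading-111121 h (1¹ ∷⟨ _ ⟩ _) _ = contradiction refl h
leading-111121 h (1² ∷⟨ _ ⟩ _) _ = contradiction refl h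
leading-111121 h (1³ ∷⟨ _ ⟩ _) _ = contradiction refl h

leading-11112 : ∀ {W} → HeadNot d2 W → Short W → Irreducible (d1 ∷ d1 ∷ d1 ∷ d1 ∷ d2 ∷ W) →
  GoodSplitting (d1 ∷ d1 ∷ d1 ∷ d1 ∷ d2 ∷ W)
leading-11112 _ [] _ = common-goodSplitting
leading-11112 _ (0¹ ∷⟨ h ⟩ V) irr =
  ⊥-elim (irreducible-cannot-split-11112 irr (λ ()) (λ ()) (short⇒bounded (0¹ ∷⟨ h ⟩ V))
            (subst OneCycle (sym (lookSay-run 0 h)) (10… (lookSay-head≢0 (short⇒bounded V)))))
leading-11112 _ (1³ ∷⟨ h ⟩ V) irr =
  ⊥-elim (irreducible-cannot-split-11112 irr (λ ()) (λ ()) b (cycle-lookSay (111… h) b))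
  where b = short⇒bounded (1³ ∷⟨ h ⟩ V)
leading-11112 _ (_∷⟨_⟩_ {W = W} 1² h V) _ =
  short-goodSplitting 2 (s≤s (s≤s z≤n))
    (subst (Short ∘ lookSay) (sym lookSay≡) (short-after-111122 (λ ()) (short-1∷lookSay h V)))
  where
  lookSay≡ : lookSay (d1 ∷ d1 ∷ d1 ∷ d1 ∷ d2 ∷ d1 ∷ d1 ∷ W) ≡
             d1 ∷ d1 ∷ d1 ∷ d1 ∷ d2 ∷ d2 ∷ d1 ∷ lookSay W
  lookSay≡ = trans (lookSay-++ {d2} {Q = d1 ∷ d1 ∷ W} (d1 ∷ d1 ∷ d1 ∷ d1 ∷ [] , refl) (λ ()))
                   (cong ((d1 ∷ d1 ∷ d1 ∷ d1 ∷ d2 ∷ []) ++_) (lookSay-run 1 h))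
leading-11112 _ (1¹ ∷⟨ h ⟩ V) irr = leading-111121 h V irr
leading-11112 h (2¹ ∷⟨ _ ⟩ _) _ = contradiction refl h
leading-11112 h (2² ∷⟨ _ ⟩ _) _ = contradiction refl h
leading-11112 h (2³ ∷⟨ _ ⟩ _) _ = contradiction refl h

leading-1111 : ∀ {W} → HeadNot d1 W → Short W → Irreducible (d1 ∷ d1 ∷ d1 ∷ d1 ∷ W) →
  GoodSplitting (d1 ∷ d1 ∷ d1 ∷ d1 ∷ W)
leading-1111 _ [] _ = short-goodSplitting 1 (s≤s z≤n) (1³ ∷⟨ tt ⟩ [])
leading-1111 _ (0¹ ∷⟨ _ ⟩ []) _ = common-goodSplitting
leading-1111 _ (0¹ ∷⟨ h ⟩ V@(_ ∷⟨ _ ⟩ _)) irr =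
  ⊥-elim (irreducible-cannot-split irr (d1 ∷ d1 ∷ d1 ∷ d1 ∷ [] , refl) (λ ())
            (iter-head≢0 (short⇒bounded V) h))
leading-1111 _ (2¹ ∷⟨ h ⟩ V) irr = leading-11112 h V irr
leading-1111 _ (2² ∷⟨ h ⟩ V) _ = short-goodSplitting 1 (s≤s z≤n) (short-after-111122 h V)
leading-1111 _ (_∷⟨_⟩_ {W = W} 2³ h V) _ =
  1 , s≤s z≤n , P ∷ Q ∷ [] ,
  subst (λ X → Splits X (P ∷ Q ∷ [])) (sym lookSay≡)
    (splits-at (d1 ∷ d1 ∷ d1 ∷ d1 ∷ [] , refl) (iter-head≢0 (short⇒bounded short-Q) (λ ()))) ,
  common-piece ∷ short-piece short-Q ∷ []
  where
  P Q : Str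
  P = d1 ∷ d1 ∷ d1 ∷ d1 ∷ d0 ∷ []
  Q = d2 ∷ lookSay W
  lookSay≡ : lookSay (d1 ∷ d1 ∷ d1 ∷ d1 ∷ d2 ∷ d2 ∷ d2 ∷ W) ≡ P ++ Q
  lookSay≡ = trans (lookSay-run 3 {W = d2 ∷ d2 ∷ d2 ∷ W} (λ ()))
                   (cong (λ X → d1 ∷ d1 ∷ d1 ∷ X) (lookSay-run 2 h))
  short-Q : Short Q
  short-Q = runsWith-tail 0 (λ ()) (runsWith-tail 0 (λ ())
              (subst Short (lookSay-run 2 h) (short-lookSay (2³ ∷⟨ h ⟩ V))))
leading-1111 h (1¹ ∷⟨ _ ⟩ _) _ = contradiction refl h
leading-1111 h (1² ∷⟨ _ ⟩ _) _ = contradiction refl h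
leading-1111 h (1³ ∷⟨ _ ⟩ _) _ = contradiction refl h

lemma4 : (A : Str) → NonEmpty A → Irreducible A → Mature A →
    Σ ℕ λ k → k ≤ 3 × Σ (List Str) λ Ps → Splits (iter k A) Ps × All GoodPiece Ps
lemma4 A A≢[] irr (bounds , _) with runBounds⇒bounded {A} bounds
... | []               = contradiction refl A≢[]
... | short s ∷⟨ h ⟩ V = short-goodSplitting 0 z≤n (s ∷⟨ h ⟩ later-runs-short irr endsIn-replicate h V)
... | 1⁴ ∷⟨ h ⟩ V      = leading-1111 h (later-runs-short irr endsIn-replicate h V) irr
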